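{- Let $\mathcal{P}$ be a deterministic protocol. If $\mathcal{P}$ tests whether the distributed linear system $Ax=b$ is feasible in the coordinator model, then its communication complexity is $\Omega(sd^2L)$. If $\mathcal{P}$ tests whether $Ax=b$ is feasible in the blackboard model, then its communication complexity is $\Omega(s + d^2L)$.
   Context: There are $s\ge2$ servers $P_1,\dots,P_s$ and a coordinator. $A\in\mathbb{R}^{n\times d}$ and $b\in\mathbb{R}^n$ have integer entries in $[-2^L,2^L]$, and the rows of $[A~b]$ are partitioned among servers ($P_i$ holds $A^{(i)}x=b^{(i)}$). Feasibility testing: the coordinator must report whether $Ax=b$ has a solution. In the coordinator model servers communicate only with the coordinator through private channels; in the blackboard model all messages are broadcast on a shared blackboard whose contents determine who speaks next. Communication complexity is the total number of bits sent. -}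

module Defs where

open import Data.Bool using (Bool; true; false)
open import Data.Nat using (ℕ; zero; suc; _^_) renaming (_+_ to _+ℕ_; _≤_ to _≤ℕ_)
open import Data.Integer using (ℤ; ∣_∣)
open import Data.Rational using (ℚ; 0ℚ; _+_; _*_; _/_)
open import Data.Fin using (Fin; zero; suc)
open import Data.List using (List; []; _∷_; _++_; [_])
open import Data.Product using (Σ; ∃; _×_; _,_)
open import Relation.Binary.PropositionalEquality using (_≡_; _≢_)

-- Linear systems over the rationals (feasibility over ℝ of
-- an integer system coincides with feasibility over ℚ).

record Row (d : ℕ) : Set where
  constructor row
  field
    coef : Fin d → ℤ
    rhs  : ℤ
open Row public

Local : ℕ → ℕ → Set
Local m d = Fin m → Row d

BoundedRow : ℕ → {d : ℕ} → Row d → Set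
BoundedRow L r = (∀ j → ∣ coef r j ∣ ≤ℕ 2 ^ L) × (∣ rhs r ∣ ≤ℕ 2 ^ L)

Input : (s : ℕ) → (Fin s → ℕ) → ℕ → Set
Input s m d = (i : Fin s) → Local (m i) d

ValidInput : (L : ℕ) {s d : ℕ} {m : Fin s → ℕ} → Input s m d → Set
ValidInput L {s} {m = m} X = (i : Fin s) (r : Fin (m i)) → BoundedRow L (X i r)

toℚ : ℤ → ℚ
toℚ z = z / 1

dot : {d : ℕ} → (Fin d → ℤ) → (Fin d → ℚ) → ℚ
dot {zero}  a x = 0ℚ
dot {suc d} a x = toℚ (a zero) * x zero + dot (λ j → a (suc j)) (λ j → x (suc j))

Satisfies : {d : ℕ} → Row d → (Fin d → ℚ) → Set
Satisfies r x = dot (coef r) x ≡ toℚ (rhs r)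

Feasible : {s d : ℕ} {m : Fin s → ℕ} → Input s m d → Set
Feasible {s} {d} {m} X = Σ (Fin d → ℚ) λ x → (i : Fin s) (r : Fin (m i)) → Satisfies (X i r) x

-- The coordinator sees everything sent to it, so its behaviour is a
-- finite decision tree.  Server i only sees its private channel: its
-- bit is a fixed function (its strategy) of its own input and the
-- history of its channel.  Every message is a single bit; multi-bit
-- messages are sequences of such bits.

data Dir : Set where
  up down : Dir      -- up: server → coordinator, down: coordinator → server

ChannelHistory : Set
ChannelHistory = List (Dir × Bool)

data CoordTree (s : ℕ) : Set where
  output : Bool → CoordTree s
  send   : Fin s → Bool → CoordTree s → CoordTree s
  recv   : Fin s → (Bool → CoordTree s) → CoordTree s

record CoordProtocol (s : ℕ) (m : Fin s → ℕ) (d : ℕ) : Set where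
  field
    tree     : CoordTree s
    strategy : (i : Fin s) → Local (m i) d → ChannelHistory → Bool
open CoordProtocol public

update : {s : ℕ} → (Fin s → ChannelHistory) → Fin s → Dir × Bool → Fin s → ChannelHistory
update {suc s} h zero    e zero    = h zero ++ [ e ]
update {suc s} h zero    e (suc k) = h (suc k)
update {suc s} h (suc i) e zero    = h zero
update {suc s} h (suc i) e (suc k) = update (λ k′ → h (suc k′)) i e k

-- Execution: returns (output, number of bits communicated).
runCoordFrom : {s d : ℕ} {m : Fin s → ℕ} →
               ((i : Fin s) → Local (m i) d → ChannelHistory → Bool) →
               Input s m d → (Fin s → ChannelHistory) → CoordTree s → Bool × ℕ
runCoordFrom σ X h (output b) = b , 0
runCoordFrom σ X h (send i b t) with runCoordFrom σ X (update h i (down , b)) t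
... | o , c = o , suc c
runCoordFrom σ X h (recv i k) with σ i (X i) (h i)
... | b with runCoordFrom σ X (update h i (up , b)) (k b)
... | o , c = o , suc c

runCoord : {s d : ℕ} {m : Fin s → ℕ} → CoordProtocol s m d → Input s m d → Bool × ℕ
runCoord P X = runCoordFrom (strategy P) X (λ _ → []) (tree P)

-- Blackboard model: every bit is broadcast, so the whole protocol is a
-- decision tree whose internal nodes name the speaker (determined by the
-- blackboard contents) and the speaker's bit as a function of its input.

data BBProtocol (s : ℕ) (m : Fin s → ℕ) (d : ℕ) : Set where
  output : Bool → BBProtocol s m d
  speak  : (i : Fin s) → (Local (m i) d → Bool) → (Bool → BBProtocol s m d) → BBProtocol s m d

runBB : {s d : ℕ} {m : Fin s → ℕ} → BBProtocol s m d → Input s m d → Bool × ℕ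
runBB (output b) X = b , 0
runBB (speak i f k) X with runBB (k (f (X i))) X
... | o , c = o , suc c

Decides : {s d : ℕ} {m : Fin s → ℕ} → ℕ → (Input s m d → Bool × ℕ) → Set
Decides {s} {d} {m} L run =
  (X : Input s m d) → ValidInput L X →
    ((Data.Product.proj₁ (run X) ≡ true) → Feasible X) ×
    (Feasible X → Data.Product.proj₁ (run X) ≡ true)

CostAtLeast : {s d : ℕ} {m : Fin s → ℕ} → ℕ → (Input s m d → Bool × ℕ) → ℕ → Set
CostAtLeast {s} {d} {m} L run c =
  Σ (Input s m d) λ X → ValidInput L X × (c ≤ℕ Data.Product.proj₂ (run X))

{-# OPTIONS --safe #-}
module Submission where

open import Defs
open import Data.Nat using (ℕ; _+_; _*_; _≤_; _<_)
open import Data.Fin using (Fin)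
open import Data.Product using (Σ; _×_)

open import Data.Nat as ℕ using (zero; suc; _^_; NonZero; >-nonZero; z≤n; s≤s; ⌊_/2⌋; ⌈_/2⌉)
import Data.Nat.Properties as ℕ
open import Data.Nat.DivMod using (_%_; _/_; m%n<n; m≡m%n+[m/n]*n; m<n*o⇒m/o<n)
import Data.Nat.ListAction as ListAction
import Data.Nat.Solver as ℕ-Solver
open import Data.Integer as ℤ using (ℤ; +_; -[1+_]; 0ℤ; 1ℤ)
import Data.Integer.Properties as ℤ
open import Data.Rational as ℚ using (ℚ; mkℚ; 0ℚ)
import Data.Rational.Properties as ℚ
import Data.Nat.Coprimality as Coprimality
open import Data.Bool as Bool using (Bool; true; false)
open import Data.Fin as Fin using (zero; suc; toℕ; _↑ˡ_; _↑ʳ_; splitAt)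
import Data.Fin.Properties as Fin
open import Data.Fin.Induction using (<-weakInduction)
open import Data.List using (List; []; _∷_; [_]; _∷ʳ_; length; map; tabulate; lookup; initLast; _∷ʳ′_)
import Data.List as List
import Data.List.Properties as List
open import Data.List.Relation.Unary.All as ListAll using ([]; _∷_)
open import Data.List.Relation.Unary.Any using (here; there)
open import Data.List.Relation.Unary.Any.Properties using (lookup-index)
open import Data.List.Relation.Unary.Unique.Propositional using (Unique; []; _∷_)
open import Data.List.Relation.Unary.Unique.Propositional.Properties using (tabulate⁺)
open import Data.List.Membership.Propositional using (_∈_)
import Data.List.Membership.DecPropositional as DecMembership
open import Data.Vec.Functional using (Vector; updateAt; _++_)
import Data.Vec.Functional.Properties as Vector
open import Data.Vec.Functional.Relation.Unary.All using (All)
import Data.Vec.Functional.Relation.Unary.All.Properties as All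
open import Data.Sum using (_⊎_; inj₁; inj₂)
open import Data.Sum.Properties using ([,]-map)
open import Data.Product using (∃; _,_; proj₁; proj₂; map₂; uncurry)
open import Function using (_∘_; const)
open import Relation.Nullary using (yes; no; contradiction)
open import Relation.Binary.PropositionalEquality hiding ([_])
import Algebra.Properties.Group ℚ.+-0-group as ℚ+
open import Algebra.Properties.CommutativeSemigroup ℕ.*-commutativeSemigroup using (x∙yz≈y∙xz)
open import Algebra.Properties.CommutativeMonoid.Sum ℕ.+-0-commutativeMonoid
  using (sum-syntax; sum-cong-≗; sum-replicate-zero; ∑-comm; ∑-distrib-+)
open import Algebra.Properties.Semiring.Sum ℕ.+-*-semiring using (*-distribˡ-sum)
open ℕ-Solver.+-*-Solver using (solve; _:+_; _:*_; _:=_; con)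

-- Write d = k + r with k = ⌊d/2⌋, r = ⌈d/2⌉, and let B = 2^L. For every V < N = B^((k+1)r)
-- there is a system of d equations with entries bounded by B: k rows force x_p = B^(p+1), and
-- r rows force x_(k+i) to be the i-th base-B^(k+1) digit of V, written through its base-B
-- digits. Each system is feasible, but no two distinct ones are jointly feasible.
--
-- When every server holds the V-th system the answer is "feasible", so by cut and paste the
-- conversation on each channel (coordinator model), or the whole transcript (blackboard
-- model), determines V. At most 2^t - 1 binary words are shorter than t, so with 2^t ≈ √N
-- these conversations have average length Ω(log N) = Ω(d²L); averaging over V yields one
-- input costing Ω(s d² L) bits with a coordinator and Ω(d² L) bits on a blackboard. On a
-- blackboard every server must moreover speak, since a silent server's system could be
-- swapped for another one unnoticed, which gives the Ω(s) term.

⟦_⟧ : ℕ → ℚ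
⟦ n ⟧ = toℚ (+ n)

toℚ≡mkℚ : ∀ z → toℚ z ≡ mkℚ z 0 (Coprimality.sym (Coprimality.1-coprimeTo ℤ.∣ z ∣))
toℚ≡mkℚ (+ n)    = ℚ.normalize-coprime (Coprimality.sym (Coprimality.1-coprimeTo n))
toℚ≡mkℚ -[1+ n ] = cong ℚ.-_ (ℚ.normalize-coprime (Coprimality.sym (Coprimality.1-coprimeTo (suc n))))

toℚ-homo-+ : ∀ a b → toℚ (a ℤ.+ b) ≡ toℚ a ℚ.+ toℚ b
toℚ-homo-+ a b rewrite toℚ≡mkℚ a | toℚ≡mkℚ b =
  cong (ℚ._/ 1) (cong₂ ℤ._+_ (sym (ℤ.*-identityʳ a)) (sym (ℤ.*-identityʳ b)))

toℚ-homo-* : ∀ a b → toℚ (a ℤ.* b) ≡ toℚ a ℚ.* toℚ b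
toℚ-homo-* a b rewrite toℚ≡mkℚ a | toℚ≡mkℚ b = refl

toℚ-homo‿- : ∀ a → toℚ (ℤ.- a) ≡ ℚ.- toℚ a
toℚ-homo‿- a = ℚ+.inverseˡ-unique (toℚ (ℤ.- a)) (toℚ a)
  (trans (sym (toℚ-homo-+ (ℤ.- a) a)) (cong toℚ (ℤ.+-inverseˡ a)))

⟦⟧-homo-+ : ∀ m n → ⟦ m + n ⟧ ≡ ⟦ m ⟧ ℚ.+ ⟦ n ⟧
⟦⟧-homo-+ m n = toℚ-homo-+ (+ m) (+ n)

⟦⟧-homo-* : ∀ m n → ⟦ m * n ⟧ ≡ ⟦ m ⟧ ℚ.* ⟦ n ⟧
⟦⟧-homo-* m n = trans (cong toℚ (ℤ.pos-* m n)) (toℚ-homo-* (+ m) (+ n))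

⟦⟧-injective : ∀ {m n} → ⟦ m ⟧ ≡ ⟦ n ⟧ → m ≡ n
⟦⟧-injective {m} {n} eq rewrite toℚ≡mkℚ (+ m) | toℚ≡mkℚ (+ n) =
  ℤ.+-injective (proj₁ (ℚ.mkℚ-injective eq))

unit : ∀ {d} → Fin d → Vector ℤ d
unit zero    zero    = 1ℤ
unit zero    (suc _) = 0ℤ
unit (suc j) zero    = 0ℤ
unit (suc j) (suc p) = unit j p

∣unit∣≤1 : ∀ {d} (j p : Fin d) → ℤ.∣ unit j p ∣ ≤ 1
∣unit∣≤1 zero    zero    = ℕ.≤-refl
∣unit∣≤1 zero    (suc p) = z≤n
∣unit∣≤1 (suc j) zero    = z≤n
∣unit∣≤1 (suc j) (suc p) = ∣unit∣≤1 j p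

dot-cong : ∀ {d} {a b : Vector ℤ d} {x y : Vector ℚ d} → a ≗ b → x ≗ y → dot a x ≡ dot b y
dot-cong {zero}  a≗b x≗y = refl
dot-cong {suc d} a≗b x≗y =
  cong₂ ℚ._+_ (cong₂ (λ c z → toℚ c ℚ.* z) (a≗b zero) (x≗y zero))
              (dot-cong (a≗b ∘ suc) (x≗y ∘ suc))

dot-zeroˡ : ∀ {d} (x : Vector ℚ d) → dot (λ _ → 0ℤ) x ≡ 0ℚ
dot-zeroˡ {zero}  x = refl
dot-zeroˡ {suc d} x = trans (cong₂ ℚ._+_ (ℚ.*-zeroˡ (x zero)) (dot-zeroˡ (x ∘ suc))) (ℚ.+-identityˡ 0ℚ)

dot-unit : ∀ {d} (j : Fin d) (x : Vector ℚ d) → dot (unit j) x ≡ x j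
dot-unit zero    x =
  trans (cong₂ ℚ._+_ (ℚ.*-identityˡ (x zero)) (dot-zeroˡ (x ∘ suc))) (ℚ.+-identityʳ (x zero))
dot-unit (suc j) x =
  trans (cong₂ ℚ._+_ (ℚ.*-zeroˡ (x zero)) (dot-unit j (x ∘ suc))) (ℚ.+-identityˡ (x (suc j)))

dot-neg : ∀ {d} (a : Vector ℤ d) (x : Vector ℚ d) → dot (λ p → ℤ.- a p) x ≡ ℚ.- dot a x
dot-neg {zero}  a x = refl
dot-neg {suc d} a x = begin
  toℚ (ℤ.- a₀) ℚ.* x zero ℚ.+ dot (λ p → ℤ.- a (suc p)) (x ∘ suc)
    ≡⟨ cong₂ ℚ._+_ (cong (ℚ._* x zero) (toℚ-homo‿- a₀)) (dot-neg (a ∘ suc) (x ∘ suc)) ⟩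
  ℚ.- toℚ a₀ ℚ.* x zero ℚ.+ ℚ.- dot (a ∘ suc) (x ∘ suc)
    ≡⟨ cong (ℚ._+ ℚ.- dot (a ∘ suc) (x ∘ suc)) (ℚ.neg-distribˡ-* (toℚ a₀) (x zero)) ⟨
  ℚ.- (toℚ a₀ ℚ.* x zero) ℚ.+ ℚ.- dot (a ∘ suc) (x ∘ suc)
    ≡⟨ ℚ.neg-distrib-+ (toℚ a₀ ℚ.* x zero) (dot (a ∘ suc) (x ∘ suc)) ⟨
  ℚ.- dot a x ∎
  where
    open ≡-Reasoning
    a₀ = a zero

dot-⟦⟧ : ∀ {d} (a b : Vector ℕ d) →
         dot (λ p → + a p) (λ p → ⟦ b p ⟧) ≡ ⟦ ∑[ p < d ] (a p * b p) ⟧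
dot-⟦⟧ {zero}  a b = refl
dot-⟦⟧ {suc d} a b = begin
  ⟦ a zero ⟧ ℚ.* ⟦ b zero ⟧ ℚ.+ dot (λ p → + a (suc p)) (λ p → ⟦ b (suc p) ⟧)
    ≡⟨ cong₂ ℚ._+_ (sym (⟦⟧-homo-* (a zero) (b zero))) (dot-⟦⟧ (a ∘ suc) (b ∘ suc)) ⟩
  ⟦ a zero * b zero ⟧ ℚ.+ ⟦ ∑[ p < d ] (a (suc p) * b (suc p)) ⟧
    ≡⟨ ⟦⟧-homo-+ (a zero * b zero) (∑[ p < d ] (a (suc p) * b (suc p))) ⟨
  ⟦ ∑[ p < suc d ] (a p * b p) ⟧ ∎
  where open ≡-Reasoning

dot-++ : ∀ {m n} (a : Vector ℤ m) (b : Vector ℤ n) (x : Vector ℚ (m + n)) →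
         dot (a ++ b) x ≡ dot a (x ∘ (_↑ˡ n)) ℚ.+ dot b (x ∘ (m ↑ʳ_))
dot-++ {zero}  a b x = sym (ℚ.+-identityˡ (dot b x))
dot-++ {suc m} {n} a b x = begin
  a₀x₀ ℚ.+ dot ((a ++ b) ∘ suc) (x ∘ suc)
    ≡⟨ cong (a₀x₀ ℚ.+_) (dot-cong (λ i → [,]-map (splitAt m i)) (λ _ → refl)) ⟩
  a₀x₀ ℚ.+ dot ((a ∘ suc) ++ b) (x ∘ suc)
    ≡⟨ cong (a₀x₀ ℚ.+_) (dot-++ (a ∘ suc) b (x ∘ suc)) ⟩
  a₀x₀ ℚ.+ (dot (a ∘ suc) (x ∘ suc ∘ (_↑ˡ n)) ℚ.+ dot b (x ∘ (suc m ↑ʳ_)))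
    ≡⟨ ℚ.+-assoc a₀x₀ (dot (a ∘ suc) (x ∘ suc ∘ (_↑ˡ n))) (dot b (x ∘ (suc m ↑ʳ_))) ⟨
  dot a (x ∘ (_↑ˡ n)) ℚ.+ dot b (x ∘ (suc m ↑ʳ_)) ∎
  where
    open ≡-Reasoning
    a₀x₀ = toℚ (a zero) ℚ.* x zero

digit : (b : ℕ) .{{_ : NonZero b}} → ℕ → ℕ → ℕ
digit b zero    v = v % b
digit b (suc i) v = digit b i (v / b)

digit<base : ∀ b .{{_ : NonZero b}} i v → digit b i v < b
digit<base b zero    v = m%n<n v b
digit<base b (suc i) v = digit<base b i (v / b)

digit-expansion : ∀ b .{{_ : NonZero b}} n {v} → v < b ^ n →
                  ∑[ p < n ] (digit b (toℕ p) v * b ^ toℕ p) ≡ v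
digit-expansion b zero    v<1 = sym (ℕ.n<1⇒n≡0 v<1)
digit-expansion b (suc n) {v} v<b^[1+n] = begin
  v % b * 1 + ∑[ p < n ] (digit b (toℕ p) (v / b) * (b * b ^ toℕ p))
    ≡⟨ cong₂ _+_ (ℕ.*-identityʳ (v % b))
                 (sum-cong-≗ {n} (λ p → x∙yz≈y∙xz (digit b (toℕ p) (v / b)) b (b ^ toℕ p))) ⟩
  v % b + ∑[ p < n ] (b * (digit b (toℕ p) (v / b) * b ^ toℕ p))
    ≡⟨ cong (λ z → v % b + z) (*-distribˡ-sum {n} b _) ⟨
  v % b + b * ∑[ p < n ] (digit b (toℕ p) (v / b) * b ^ toℕ p)
    ≡⟨ cong (λ z → v % b + b * z) (digit-expansion b n v/b<b^n) ⟩
  v % b + b * (v / b)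
    ≡⟨ cong (λ z → v % b + z) (ℕ.*-comm b (v / b)) ⟩
  v % b + v / b * b
    ≡⟨ m≡m%n+[m/n]*n v b ⟨
  v ∎
  where
    open ≡-Reasoning
    v/b<b^n : v / b < b ^ n
    v/b<b^n = m<n*o⇒m/o<n (subst (v <_) (ℕ.*-comm b (b ^ n)) v<b^[1+n])

digit-injective : ∀ b .{{_ : NonZero b}} n {u v} → u < b ^ n → v < b ^ n →
                  (∀ (p : Fin n) → digit b (toℕ p) u ≡ digit b (toℕ p) v) → u ≡ v
digit-injective b n {u} {v} u<b^n v<b^n same = begin
  u                                          ≡⟨ digit-expansion b n u<b^n ⟨
  ∑[ p < n ] (digit b (toℕ p) u * b ^ toℕ p) ≡⟨ sum-cong-≗ {n} (λ p → cong (_* b ^ toℕ p) (same p)) ⟩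
  ∑[ p < n ] (digit b (toℕ p) v * b ^ toℕ p) ≡⟨ digit-expansion b n v<b^n ⟩
  v                                          ∎
  where open ≡-Reasoning

-- A fooling set of linear systems

Solves : ∀ {m d} → Local m d → Vector ℚ d → Set
Solves S x = All (λ R → Satisfies R x) S

padʳ : ∀ {k} r → Row k → Row (k + r)
padʳ r R = row (coef R ++ λ _ → 0ℤ) (rhs R)

dot-padʳ : ∀ {k} r (R : Row k) (x : Vector ℚ (k + r)) →
           dot (coef (padʳ r R)) x ≡ dot (coef R) (x ∘ (_↑ˡ r))
dot-padʳ {k} r R x =
  trans (dot-++ (coef R) (λ _ → 0ℤ) x)
        (trans (cong (dot (coef R) (x ∘ (_↑ˡ r)) ℚ.+_) (dot-zeroˡ (x ∘ (k ↑ʳ_)))) (ℚ.+-identityʳ _))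

module Powers (B : ℕ) where

  ratioCoef : ∀ {k} → Fin k → Vector ℤ (suc k)
  ratioCoef zero    zero    = ℤ.- + B
  ratioCoef zero    (suc p) = unit zero p
  ratioCoef (suc q) zero    = 0ℤ
  ratioCoef (suc q) (suc p) = ratioCoef q p

  powerRows : ∀ {k} → Local k k
  powerRows zero    = row (unit zero) (+ B)
  powerRows (suc q) = row (ratioCoef q) 0ℤ

  powers : ∀ {k} → Vector ℚ k
  powers p = ⟦ B ^ suc (toℕ p) ⟧

  dot-ratioCoef : ∀ {k} (q : Fin k) (y : Vector ℚ (suc k)) →
                  dot (ratioCoef q) y ≡ y (suc q) ℚ.- ⟦ B ⟧ ℚ.* y (Fin.inject₁ q)
  dot-ratioCoef zero    y = begin
    toℚ (ℤ.- + B) ℚ.* y zero ℚ.+ dot (unit zero) (y ∘ suc)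
      ≡⟨ cong₂ ℚ._+_ (cong (ℚ._* y zero) (toℚ-homo‿- (+ B))) (dot-unit zero (y ∘ suc)) ⟩
    ℚ.- ⟦ B ⟧ ℚ.* y zero ℚ.+ y (suc zero)
      ≡⟨ cong (ℚ._+ y (suc zero)) (ℚ.neg-distribˡ-* ⟦ B ⟧ (y zero)) ⟨
    ℚ.- (⟦ B ⟧ ℚ.* y zero) ℚ.+ y (suc zero)
      ≡⟨ ℚ.+-comm (ℚ.- (⟦ B ⟧ ℚ.* y zero)) (y (suc zero)) ⟩
    y (suc zero) ℚ.- ⟦ B ⟧ ℚ.* y zero ∎
    where open ≡-Reasoning
  dot-ratioCoef (suc q) y =
    trans (cong₂ ℚ._+_ (ℚ.*-zeroˡ (y zero)) (dot-ratioCoef q (y ∘ suc))) (ℚ.+-identityˡ _)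

  ∣ratioCoef∣≤B : 1 ≤ B → ∀ {k} (q : Fin k) p → ℤ.∣ ratioCoef q p ∣ ≤ B
  ∣ratioCoef∣≤B 1≤B zero    zero    = ℕ.≤-reflexive (ℤ.∣-i∣≡∣i∣ (+ B))
  ∣ratioCoef∣≤B 1≤B zero    (suc p) = ℕ.≤-trans (∣unit∣≤1 zero p) 1≤B
  ∣ratioCoef∣≤B 1≤B (suc q) zero    = z≤n
  ∣ratioCoef∣≤B 1≤B (suc q) (suc p) = ∣ratioCoef∣≤B 1≤B q p

  powers-suc : ∀ {k} (q : Fin k) → powers {suc k} (suc q) ≡ ⟦ B ⟧ ℚ.* powers (Fin.inject₁ q)
  powers-suc q = begin
    ⟦ B * B ^ suc (toℕ q) ⟧
      ≡⟨ ⟦⟧-homo-* B (B ^ suc (toℕ q)) ⟩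
    ⟦ B ⟧ ℚ.* ⟦ B ^ suc (toℕ q) ⟧
      ≡⟨ cong (λ i → ⟦ B ⟧ ℚ.* ⟦ B ^ suc i ⟧) (Fin.toℕ-inject₁ q) ⟨
    ⟦ B ⟧ ℚ.* ⟦ B ^ suc (toℕ (Fin.inject₁ q)) ⟧ ∎
    where open ≡-Reasoning

  powers-solve : ∀ {k} → Solves (powerRows {k}) powers
  powers-solve {suc k} zero    = trans (dot-unit zero (powers {suc k})) (cong ⟦_⟧ (ℕ.*-identityʳ B))
  powers-solve {suc k} (suc q) = trans (dot-ratioCoef q powers) (ℚ+.x≈y⇒x∙y⁻¹≈ε (powers-suc q))

  powers-unique : ∀ {k} {y : Vector ℚ k} → Solves powerRows y → y ≗ powers
  powers-unique {suc k} {y} sol = <-weakInduction (λ p → y p ≡ powers p) y₀≡B y-step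
    where
      y₀≡B : y zero ≡ powers {suc k} zero
      y₀≡B = trans (sym (dot-unit zero y)) (trans (sol zero) (cong ⟦_⟧ (sym (ℕ.*-identityʳ B))))
      y-step : ∀ q → y (Fin.inject₁ q) ≡ powers (Fin.inject₁ q) → y (suc q) ≡ powers (suc q)
      y-step q ih = begin
        y (suc q)
          ≡⟨ ℚ+.x∙y⁻¹≈ε⇒x≈y _ _ (trans (sym (dot-ratioCoef q y)) (sol (suc q))) ⟩
        ⟦ B ⟧ ℚ.* y (Fin.inject₁ q)       ≡⟨ cong (⟦ B ⟧ ℚ.*_) ih ⟩
        ⟦ B ⟧ ℚ.* powers (Fin.inject₁ q)  ≡⟨ powers-suc q ⟨
        powers (suc q)                    ∎
        where open ≡-Reasoning

record FoolingSet (L m d N : ℕ) : Set where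
  field
    system       : Fin N → Local m d
    bounded      : ∀ V r → BoundedRow L (system V r)
    solvable     : ∀ V → ∃ (Solves (system V))
    incompatible : ∀ {V W x} → Solves (system V) x → Solves (system W) x → V ≡ W

module Gadget (L k r : ℕ) where

  B : ℕ
  B = 2 ^ L

  C : ℕ
  C = B ^ suc k

  instance
    B≢0 : NonZero B
    B≢0 = ℕ.m^n≢0 2 L
    C≢0 : NonZero C
    C≢0 = ℕ.m^n≢0 B (suc k)

  open Powers B

  highDigits : ℕ → Vector ℕ k
  highDigits v p = digit B (suc (toℕ p)) v

  high : ℕ → ℕ
  high v = ∑[ p < k ] (highDigits v p * B ^ suc (toℕ p))

  low+high : ∀ {v} → v < C → digit B 0 v + high v ≡ v
  low+high {v} v<C = trans (cong (_+ high v) (sym (ℕ.*-identityʳ (digit B 0 v)))) (digit-expansion B (suc k) v<C)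

  blockRow : ℕ → Fin r → Row (k + r)
  blockRow v i = row ((λ p → ℤ.- + highDigits v p) ++ unit i) (+ digit B 0 v)

  block : ℕ → Fin r → ℕ
  block V i = digit C (toℕ i) V

  system : ℕ → Local (k + r) (k + r)
  system V = (padʳ r ∘ powerRows) ++ (λ i → blockRow (block V i) i)

  dot-blockRow : ∀ v i {x : Vector ℚ (k + r)} → x ∘ (_↑ˡ r) ≗ powers →
                 dot (coef (blockRow v i)) x ≡ x (k ↑ʳ i) ℚ.- ⟦ high v ⟧
  dot-blockRow v i {x} x≗powers = begin
    dot (coef (blockRow v i)) x
      ≡⟨ dot-++ (λ p → ℤ.- + highDigits v p) (unit i) x ⟩
    dot (λ p → ℤ.- + highDigits v p) (x ∘ (_↑ˡ r)) ℚ.+ dot (unit i) (x ∘ (k ↑ʳ_))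
      ≡⟨ cong₂ ℚ._+_ (dot-neg (λ p → + highDigits v p) (x ∘ (_↑ˡ r))) (dot-unit i (x ∘ (k ↑ʳ_))) ⟩
    ℚ.- dot (λ p → + highDigits v p) (x ∘ (_↑ˡ r)) ℚ.+ x (k ↑ʳ i)
      ≡⟨ cong (λ z → ℚ.- z ℚ.+ x (k ↑ʳ i)) (dot-cong (λ _ → refl) x≗powers) ⟩
    ℚ.- dot (λ p → + highDigits v p) powers ℚ.+ x (k ↑ʳ i)
      ≡⟨ cong (λ z → ℚ.- z ℚ.+ x (k ↑ʳ i)) (dot-⟦⟧ (highDigits v) (λ p → B ^ suc (toℕ p))) ⟩
    ℚ.- ⟦ high v ⟧ ℚ.+ x (k ↑ʳ i)
      ≡⟨ ℚ.+-comm (ℚ.- ⟦ high v ⟧) (x (k ↑ʳ i)) ⟩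
    x (k ↑ʳ i) ℚ.- ⟦ high v ⟧ ∎
    where open ≡-Reasoning

  blockRow-solve : ∀ {v} i {x : Vector ℚ (k + r)} → v < C → x ∘ (_↑ˡ r) ≗ powers →
                   x (k ↑ʳ i) ≡ ⟦ v ⟧ → Satisfies (blockRow v i) x
  blockRow-solve {v} i {x} v<C x≗powers xᵢ≡v = begin
    dot (coef (blockRow v i)) x
      ≡⟨ dot-blockRow v i x≗powers ⟩
    x (k ↑ʳ i) ℚ.- ⟦ high v ⟧
      ≡⟨ cong (ℚ._- ⟦ high v ⟧) xᵢ≡v ⟩
    ⟦ v ⟧ ℚ.- ⟦ high v ⟧
      ≡⟨ cong (λ z → ⟦ z ⟧ ℚ.- ⟦ high v ⟧) (low+high v<C) ⟨
    ⟦ digit B 0 v + high v ⟧ ℚ.- ⟦ high v ⟧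
      ≡⟨ cong (ℚ._- ⟦ high v ⟧) (⟦⟧-homo-+ (digit B 0 v) (high v)) ⟩
    (⟦ digit B 0 v ⟧ ℚ.+ ⟦ high v ⟧) ℚ.- ⟦ high v ⟧
      ≡⟨ ℚ+.//-rightDividesʳ ⟦ high v ⟧ ⟦ digit B 0 v ⟧ ⟩
    ⟦ digit B 0 v ⟧ ∎
    where open ≡-Reasoning

  blockRow-forces : ∀ {v} i {x : Vector ℚ (k + r)} → v < C → x ∘ (_↑ˡ r) ≗ powers →
                    Satisfies (blockRow v i) x → x (k ↑ʳ i) ≡ ⟦ v ⟧
  blockRow-forces {v} i {x} v<C x≗powers sat = begin
    x (k ↑ʳ i)
      ≡⟨ ℚ+.//-rightDividesˡ ⟦ high v ⟧ (x (k ↑ʳ i)) ⟨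
    (x (k ↑ʳ i) ℚ.- ⟦ high v ⟧) ℚ.+ ⟦ high v ⟧
      ≡⟨ cong (ℚ._+ ⟦ high v ⟧) (trans (sym (dot-blockRow v i x≗powers)) sat) ⟩
    ⟦ digit B 0 v ⟧ ℚ.+ ⟦ high v ⟧
      ≡⟨ ⟦⟧-homo-+ (digit B 0 v) (high v) ⟨
    ⟦ digit B 0 v + high v ⟧
      ≡⟨ cong ⟦_⟧ (low+high v<C) ⟩
    ⟦ v ⟧ ∎
    where open ≡-Reasoning

  solution : ℕ → Vector ℚ (k + r)
  solution V = powers ++ (λ i → ⟦ block V i ⟧)

  solution-solves : ∀ V → Solves (system V) (solution V)
  solution-solves V = All.++⁺ (λ R → Satisfies R (solution V)) solves-powerRows solves-blockRows
    where
      x≗powers : solution V ∘ (_↑ˡ r) ≗ powers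
      x≗powers = Vector.lookup-++ˡ (powers {k}) (λ i → ⟦ block V i ⟧)
      solves-powerRows : ∀ q → Satisfies (padʳ r (powerRows q)) (solution V)
      solves-powerRows q = trans (dot-padʳ r (powerRows q) (solution V))
                                 (trans (dot-cong (λ _ → refl) x≗powers) (powers-solve q))
      solves-blockRows : ∀ i → Satisfies (blockRow (block V i) i) (solution V)
      solves-blockRows i = blockRow-solve i (digit<base C (toℕ i) V) x≗powers
                                          (Vector.lookup-++ʳ (powers {k}) (λ i → ⟦ block V i ⟧) i)

  system-forces : ∀ V {x} → Solves (system V) x → ∀ i → x (k ↑ʳ i) ≡ ⟦ block V i ⟧
  system-forces V {x} sol i =
    blockRow-forces i (digit<base C (toℕ i) V) x≗powers (All.++⁻ʳ (λ R → Satisfies R x) _ sol i)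
    where
      x≗powers : x ∘ (_↑ˡ r) ≗ powers
      x≗powers = powers-unique λ q →
        trans (sym (dot-padʳ r (powerRows q) x)) (All.++⁻ˡ (λ R → Satisfies R x) _ sol q)

  system-bounded : ∀ V → All (BoundedRow L) (system V)
  system-bounded V = All.++⁺ (BoundedRow L) powerRow-bounded blockRow-bounded
    where
      1≤B : 1 ≤ B
      1≤B = ℕ.m^n>0 2 L
      Bounded : ℤ → Set
      Bounded a = ℤ.∣ a ∣ ≤ B
      ∣unit∣≤B : ∀ {d} (j p : Fin d) → Bounded (unit j p)
      ∣unit∣≤B j p = ℕ.≤-trans (∣unit∣≤1 j p) 1≤B
      powerRow-bounded : ∀ q → BoundedRow L (padʳ r (powerRows q))
      powerRow-bounded zero    = All.++⁺ Bounded (∣unit∣≤B zero) (λ _ → z≤n) , ℕ.≤-refl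
      powerRow-bounded (suc q) = All.++⁺ Bounded (∣ratioCoef∣≤B 1≤B q) (λ _ → z≤n) , z≤n
      blockRow-bounded : ∀ i → BoundedRow L (blockRow (block V i) i)
      blockRow-bounded i =
        All.++⁺ Bounded
          (λ p → ℕ.≤-trans (ℕ.≤-reflexive (ℤ.∣-i∣≡∣i∣ (+ highDigits v p)))
                           (ℕ.<⇒≤ (digit<base B (suc (toℕ p)) v)))
          (∣unit∣≤B i)
        , ℕ.<⇒≤ (digit<base B 0 v)
        where v = block V i

  foolingSet : FoolingSet L (k + r) (k + r) (C ^ r)
  foolingSet = record
    { system       = system ∘ toℕ
    ; bounded      = system-bounded ∘ toℕ
    ; solvable     = λ V → solution (toℕ V) , solution-solves (toℕ V)
    ; incompatible = λ {V} {W} solV solW → Fin.toℕ-injective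
        (digit-injective C r (Fin.toℕ<n V) (Fin.toℕ<n W) λ i →
          ⟦⟧-injective (trans (sym (system-forces (toℕ V) solV i)) (system-forces (toℕ W) solW i)))
    }

gadget : ∀ d L → FoolingSet L d d (2 ^ (L * (suc ⌊ d /2⌋ * ⌈ d /2⌉)))
gadget d L = subst₂ (λ e N → FoolingSet L e e N) (ℕ.⌊n/2⌋+⌈n/2⌉≡n d) size (Gadget.foolingSet L k r)
  where
    k = ⌊ d /2⌋
    r = ⌈ d /2⌉
    size : ((2 ^ L) ^ suc k) ^ r ≡ 2 ^ (L * (suc k * r))
    size = begin
      ((2 ^ L) ^ suc k) ^ r   ≡⟨ cong (_^ r) (ℕ.^-*-assoc 2 L (suc k)) ⟩
      (2 ^ (L * suc k)) ^ r   ≡⟨ ℕ.^-*-assoc 2 (L * suc k) r ⟩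
      2 ^ (L * suc k * r)     ≡⟨ cong (2 ^_) (ℕ.*-assoc L (suc k) r) ⟩
      2 ^ (L * (suc k * r))   ∎
      where open ≡-Reasoning

-- Distinct binary words are long on average

-- #shorter t = 2^t - 1 is the number of binary words of length less than t.
#shorter : ℕ → ℕ
#shorter zero    = 0
#shorter (suc t) = suc (2 * #shorter t)

#shorter-pos : ∀ t → 0 < t → 0 < #shorter t
#shorter-pos (suc t) _ = s≤s z≤n

tailsOf : Bool → List (List Bool) → List (List Bool)
tailsOf b []             = []
tailsOf b ([] ∷ ws)      = tailsOf b ws
tailsOf b ((c ∷ w) ∷ ws) with c Bool.≟ b
... | yes _ = w ∷ tailsOf b ws
... | no  _ = tailsOf b ws

∈-tailsOf : ∀ b ws {w} → w ∈ tailsOf b ws → (b ∷ w) ∈ ws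
∈-tailsOf b ([] ∷ ws)      w∈ = there (∈-tailsOf b ws w∈)
∈-tailsOf b ((c ∷ u) ∷ ws) w∈ with c Bool.≟ b | w∈
... | yes refl | here refl = here refl
... | yes refl | there w∈′ = there (∈-tailsOf b ws w∈′)
... | no  _    | w∈′       = there (∈-tailsOf b ws w∈′)

tailsOf-unique : ∀ b {ws} → Unique ws → Unique (tailsOf b ws)
tailsOf-unique b {[]}           []           = []
tailsOf-unique b {[] ∷ ws}      (_ ∷ u)      = tailsOf-unique b u
tailsOf-unique b {(c ∷ w) ∷ ws} (w∉ws ∷ u) with c Bool.≟ b
... | yes refl = w∉tails ∷ tailsOf-unique b u
  where w∉tails = ListAll.tabulate λ v∈ w≡v → ListAll.lookup w∉ws (∈-tailsOf b ws v∈) (cong (b ∷_) w≡v)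
... | no  _    = tailsOf-unique b u

length-tailsOf : ∀ ws → ListAll.All (_≢ []) ws →
                 length ws ≡ length (tailsOf true ws) + length (tailsOf false ws)
length-tailsOf []                 []          = refl
length-tailsOf ([] ∷ ws)          ([]≢[] ∷ _) = contradiction refl []≢[]
length-tailsOf ((true ∷ w) ∷ ws)  (_ ∷ ne)    = cong suc (length-tailsOf ws ne)
length-tailsOf ((false ∷ w) ∷ ws) (_ ∷ ne)    = trans (cong suc (length-tailsOf ws ne)) (sym (ℕ.+-suc _ _))

length≤1+tailsOf : ∀ {ws} → Unique ws →
                   length ws ≤ suc (length (tailsOf true ws) + length (tailsOf false ws))
length≤1+tailsOf {[]}               []          = z≤n
length≤1+tailsOf {[] ∷ ws}          ([]∉ws ∷ _) =
  s≤s (ℕ.≤-reflexive (length-tailsOf ws (ListAll.map (λ []≢w → []≢w ∘ sym) []∉ws)))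
length≤1+tailsOf {(true ∷ w) ∷ ws}  (_ ∷ u)     = s≤s (length≤1+tailsOf u)
length≤1+tailsOf {(false ∷ w) ∷ ws} (_ ∷ u)     =
  ℕ.≤-trans (s≤s (length≤1+tailsOf u)) (ℕ.≤-reflexive (cong suc (sym (ℕ.+-suc _ _))))

totalLength : List (List Bool) → ℕ
totalLength ws = ListAction.sum (map length ws)

totalLength-tailsOf : ∀ ws → totalLength ws ≡
  (length (tailsOf true ws) + totalLength (tailsOf true ws)) +
  (length (tailsOf false ws) + totalLength (tailsOf false ws))
totalLength-tailsOf []                 = refl
totalLength-tailsOf ([] ∷ ws)          = totalLength-tailsOf ws
totalLength-tailsOf ((true ∷ w) ∷ ws)  =
  trans (cong (λ n → suc (length w) + n) (totalLength-tailsOf ws))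
        (solve 5 (λ w a b c d → con 1 :+ w :+ ((a :+ b) :+ (c :+ d))
                             := (con 1 :+ a :+ (w :+ b)) :+ (c :+ d)) refl (length w) a b c d)
  where a = length (tailsOf true ws) ; b = totalLength (tailsOf true ws)
        c = length (tailsOf false ws); d = totalLength (tailsOf false ws)
totalLength-tailsOf ((false ∷ w) ∷ ws) =
  trans (cong (λ n → suc (length w) + n) (totalLength-tailsOf ws))
        (solve 5 (λ w a b c d → con 1 :+ w :+ ((a :+ b) :+ (c :+ d))
                             := (a :+ b) :+ (con 1 :+ c :+ (w :+ d))) refl (length w) a b c d)
  where a = length (tailsOf true ws) ; b = totalLength (tailsOf true ws)
        c = length (tailsOf false ws); d = totalLength (tailsOf false ws)

totalLength-lower-bound : ∀ t {ws} → Unique ws → t * length ws ≤ totalLength ws + t * #shorter t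
totalLength-lower-bound zero    _ = z≤n
totalLength-lower-bound (suc t) {ws} u = begin
  suc t * length ws
    ≤⟨ ℕ.*-monoʳ-≤ (suc t) (length≤1+tailsOf u) ⟩
  suc t * suc (a + c)
    ≡⟨ solve 3 (λ t a c → (con 1 :+ t) :* (con 1 :+ (a :+ c))
                       := (con 1 :+ t) :+ (a :+ c) :+ (t :* a :+ t :* c)) refl t a c ⟩
  suc t + (a + c) + (t * a + t * c)
    ≤⟨ ℕ.+-monoʳ-≤ (suc t + (a + c)) (ℕ.+-mono-≤ (IH true) (IH false)) ⟩
  suc t + (a + c) + ((b + t * g) + (d + t * g))
    ≤⟨ ℕ.m≤m+n _ (2 * g) ⟩
  suc t + (a + c) + ((b + t * g) + (d + t * g)) + 2 * g
    ≡⟨ solve 6 (λ t a b c d g → (con 1 :+ t) :+ (a :+ c) :+ ((b :+ t :* g) :+ (d :+ t :* g)) :+ con 2 :* g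
                             := (a :+ b) :+ (c :+ d) :+ (con 1 :+ t) :* (con 1 :+ con 2 :* g)) refl t a b c d g ⟩
  (a + b) + (c + d) + suc t * #shorter (suc t)
    ≡⟨ cong (_+ suc t * #shorter (suc t)) (totalLength-tailsOf ws) ⟨
  totalLength ws + suc t * #shorter (suc t) ∎
  where
    open ℕ.≤-Reasoning
    a = length (tailsOf true ws)
    b = totalLength (tailsOf true ws)
    c = length (tailsOf false ws)
    d = totalLength (tailsOf false ws)
    g = #shorter t
    IH : ∀ x → t * length (tailsOf x ws) ≤ totalLength (tailsOf x ws) + t * g
    IH x = totalLength-lower-bound t (tailsOf-unique x u)

totalLength-tabulate : ∀ {N} (w : Fin N → List Bool) → totalLength (tabulate w) ≡ ∑[ V < N ] length (w V)
totalLength-tabulate {zero}  w = refl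
totalLength-tabulate {suc N} w = cong (λ n → length (w zero) + n) (totalLength-tabulate (w ∘ suc))

∑-length-lower-bound : ∀ t {N} (w : Fin N → List Bool) → (∀ {V W} → w V ≡ w W → V ≡ W) →
                       t * N ≤ ∑[ V < N ] length (w V) + t * #shorter t
∑-length-lower-bound t w injective =
  subst₂ (λ n S → t * n ≤ S + t * #shorter t) (List.length-tabulate w) (totalLength-tabulate w)
    (totalLength-lower-bound t (tabulate⁺ injective))

-- The coordinator model

Strategies : (s : ℕ) → (Fin s → ℕ) → ℕ → Set
Strategies s m d = (i : Fin s) → Local (m i) d → ChannelHistory → Bool

Histories : ℕ → Set
Histories s = Fin s → ChannelHistory

update-≡ : ∀ {s} (h : Histories s) i e → update h i e i ≡ h i ∷ʳ e
update-≡ {suc s} h zero    e = refl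
update-≡ {suc s} h (suc i) e = update-≡ (h ∘ suc) i e

update-≢ : ∀ {s} (h : Histories s) {i} e {j} → j ≢ i → update h i e j ≡ h j
update-≢ {suc s} h {zero}  e {zero}  j≢i = contradiction refl j≢i
update-≢ {suc s} h {zero}  e {suc j} j≢i = refl
update-≢ {suc s} h {suc i} e {zero}  j≢i = refl
update-≢ {suc s} h {suc i} e {suc j} j≢i = update-≢ (h ∘ suc) e (j≢i ∘ cong suc)

∑-length-update : ∀ {s} (h : Histories s) i e →
                  ∑[ j < s ] length (update h i e j) ≡ suc (∑[ j < s ] length (h j))
∑-length-update {suc s} h zero    e =
  cong (_+ ∑[ j < s ] length (h (suc j))) (trans (List.length-++ (h zero)) (ℕ.+-comm _ 1))
∑-length-update {suc s} h (suc i) e =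
  trans (cong (λ n → length (h zero) + n) (∑-length-update (h ∘ suc) i e)) (ℕ.+-suc _ _)

data Consistent (f : ChannelHistory → Bool) : ChannelHistory → Set where
  []       : Consistent f []
  received : ∀ {H} b → Consistent f H → Consistent f (H ∷ʳ (down , b))
  sent     : ∀ {H} → Consistent f H → Consistent f (H ∷ʳ (up , f H))

∷ʳ-cancel : ∀ {A : Set} (H pre : List A) {x e e′} post →
            H ∷ʳ e ≡ pre List.++ x ∷ (post ∷ʳ e′) → H ≡ pre List.++ x ∷ post
∷ʳ-cancel H pre {x} post eq =
  List.∷ʳ-injectiveˡ H (pre List.++ x ∷ post) (trans eq (sym (List.++-assoc pre (x ∷ post) _)))

consistent-sent : ∀ {f H} → Consistent f H →
                  ∀ pre {b} post → H ≡ pre List.++ (up , b) ∷ post → f pre ≡ b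
consistent-sent [] []      post ()
consistent-sent [] (_ ∷ _) post ()
consistent-sent (received {H} c cons) pre post eq with initLast post
... | []          = contradiction (List.∷ʳ-injectiveʳ H pre eq) (λ ())
... | post′ ∷ʳ′ _ = consistent-sent cons pre post′ (∷ʳ-cancel H pre post′ eq)
consistent-sent {f} (sent {H} cons) pre post eq with initLast post
... | []          =
  trans (cong f (sym (List.∷ʳ-injectiveˡ H pre eq))) (cong proj₂ (List.∷ʳ-injectiveʳ H pre eq))
... | post′ ∷ʳ′ _ = consistent-sent cons pre post′ (∷ʳ-cancel H pre post′ eq)

module Run {s d : ℕ} {m : Fin s → ℕ} (σ : Strategies s m d) where

  histories : Input s m d → Histories s → CoordTree s → Histories s
  histories X h (output _)   = h
  histories X h (send i b t) = histories X (update h i (down , b)) t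
  histories X h (recv i k)   = histories X (update h i (up , b)) (k b)
    where b = σ i (X i) (h i)

  empty : Histories s
  empty _ = []

  cost≡∑-length-update : ∀ X h i e t →
    suc (proj₂ (runCoordFrom σ X (update h i e) t)) + ∑[ j < s ] length (h j)
      ≡ ∑[ j < s ] length (histories X (update h i e) t j)

  cost≡∑-length : ∀ X h t →
    proj₂ (runCoordFrom σ X h t) + ∑[ j < s ] length (h j) ≡ ∑[ j < s ] length (histories X h t j)
  cost≡∑-length X h (output _)   = refl
  cost≡∑-length X h (send i b t) = cost≡∑-length-update X h i (down , b) t
  cost≡∑-length X h (recv i k)   = cost≡∑-length-update X h i (up , b) (k b)
    where b = σ i (X i) (h i)

  cost≡∑-length-update X h i e t = begin
    suc (c + ∑[ j < s ] length (h j))         ≡⟨ ℕ.+-suc c _ ⟨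
    c + suc (∑[ j < s ] length (h j))         ≡⟨ cong (λ n → c + n) (∑-length-update h i e) ⟨
    c + ∑[ j < s ] length (update h i e j)    ≡⟨ cost≡∑-length X (update h i e) t ⟩
    ∑[ j < s ] length (histories X (update h i e) t j) ∎
    where
      open ≡-Reasoning
      c = proj₂ (runCoordFrom σ X (update h i e) t)

  update-extends : ∀ (h : Histories s) i e j → ∃ λ post → update h i e j ≡ h j List.++ post
  update-extends h i e j with j Fin.≟ i
  ... | yes refl = [ e ] , update-≡ h i e
  ... | no  j≢i  = [] , trans (update-≢ h e j≢i) (sym (List.++-identityʳ (h j)))

  histories-extend-update : ∀ X h i e t j → ∃ λ post → histories X (update h i e) t j ≡ h j List.++ post

  histories-extend : ∀ X h t j → ∃ λ post → histories X h t j ≡ h j List.++ post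
  histories-extend X h (output _)   j = [] , sym (List.++-identityʳ (h j))
  histories-extend X h (send i b t) j = histories-extend-update X h i (down , b) t j
  histories-extend X h (recv i k)   j = histories-extend-update X h i (up , b) (k b) j
    where b = σ i (X i) (h i)

  histories-extend-update X h i e t j
    with update-extends h i e j | histories-extend X (update h i e) t j
  ... | post₁ , eq₁ | post₂ , eq₂ =
    post₁ List.++ post₂ , trans eq₂ (trans (cong (List._++ post₂) eq₁) (List.++-assoc (h j) post₁ post₂))

  AllConsistent : Input s m d → Histories s → Set
  AllConsistent X h = ∀ j → Consistent (σ j (X j)) (h j)

  update-consistent : ∀ {X h} i e → AllConsistent X h → Consistent (σ i (X i)) (h i ∷ʳ e) →
                      AllConsistent X (update h i e)
  update-consistent {X} {h} i e cons cons-i j with j Fin.≟ i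
  ... | yes refl = subst (Consistent (σ j (X j))) (sym (update-≡ h j e)) cons-i
  ... | no  j≢i  = subst (Consistent (σ j (X j))) (sym (update-≢ h e j≢i)) (cons j)

  histories-consistent : ∀ X {h} t → AllConsistent X h → AllConsistent X (histories X h t)
  histories-consistent X (output _)   cons = cons
  histories-consistent X (send i b t) cons =
    histories-consistent X t (update-consistent i _ cons (received b (cons i)))
  histories-consistent X (recv i k)   cons =
    histories-consistent X (k _) (update-consistent i _ cons (sent (cons i)))

  output-cut : ∀ {X Z} i h t → (∀ j → j ≢ i → Z j ≡ X j) → Consistent (σ i (Z i)) (histories X h t i) →
               proj₁ (runCoordFrom σ Z h t) ≡ proj₁ (runCoordFrom σ X h t)
  output-cut i h (output _)   agree cons = refl
  output-cut i h (send j b t) agree cons = output-cut i (update h j (down , b)) t agree cons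
  output-cut {X} {Z} i h (recv j k) agree cons =
    trans (cong (λ b → proj₁ (runCoordFrom σ Z (update h j (up , b)) (k b))) same-bit)
          (output-cut i (update h j (up , bX)) (k bX) agree cons)
    where
      bX = σ j (X j) (h j)
      same-bit : σ j (Z j) (h j) ≡ bX
      same-bit with j Fin.≟ i
      ... | no j≢i = cong (λ S → σ j S (h j)) (agree j j≢i)
      ... | yes refl with histories-extend X (update h j (up , bX)) (k bX) j
      ...   | post , eq = consistent-sent cons (h j) post
        (trans eq (trans (cong (List._++ post) (update-≡ h j _)) (List.++-assoc (h j) [ (up , bX) ] post)))

  rectangle : ∀ {X Y Z} t i → histories X empty t i ≡ histories Y empty t i →
              Z i ≡ Y i → (∀ j → j ≢ i → Z j ≡ X j) →
              proj₁ (runCoordFrom σ Z empty t) ≡ proj₁ (runCoordFrom σ X empty t)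
  rectangle {X} {Y} t i same-history Zi≡Yi agree = output-cut i empty t agree
    (subst₂ (λ S H → Consistent (σ i S) H) (sym Zi≡Yi) (sym same-history)
      (histories-consistent Y t (λ _ → []) i))

encode : ChannelHistory → List Bool
encode []               = []
encode ((up   , b) ∷ h) = true  ∷ b ∷ encode h
encode ((down , b) ∷ h) = false ∷ b ∷ encode h

length-encode : ∀ h → length (encode h) ≡ 2 * length h
length-encode []               = refl
length-encode ((up   , b) ∷ h) = trans (cong (λ n → suc (suc n)) (length-encode h)) (sym (ℕ.*-suc 2 (length h)))
length-encode ((down , b) ∷ h) = trans (cong (λ n → suc (suc n)) (length-encode h)) (sym (ℕ.*-suc 2 (length h)))

encode-injective : ∀ {g h} → encode g ≡ encode h → g ≡ h
encode-injective {[]}             {[]}             _  = refl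
encode-injective {(up   , _) ∷ g} {(up   , _) ∷ h} eq =
  cong₂ _∷_ (cong (up ,_) (List.∷-injectiveˡ (List.∷-injectiveʳ eq)))
            (encode-injective (List.∷-injectiveʳ (List.∷-injectiveʳ eq)))
encode-injective {(down , _) ∷ g} {(down , _) ∷ h} eq =
  cong₂ _∷_ (cong (down ,_) (List.∷-injectiveˡ (List.∷-injectiveʳ eq)))
            (encode-injective (List.∷-injectiveʳ (List.∷-injectiveʳ eq)))
encode-injective {[]}             {(up   , _) ∷ _} ()
encode-injective {[]}             {(down , _) ∷ _} ()
encode-injective {(up   , _) ∷ _} {[]}             ()
encode-injective {(down , _) ∷ _} {[]}             ()
encode-injective {(up   , _) ∷ _} {(down , _) ∷ _} ()
encode-injective {(down , _) ∷ _} {(up   , _) ∷ _} ()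

-- The blackboard model

module BlackboardModel {s d : ℕ} {m : Fin s → ℕ} where

  transcript : BBProtocol s m d → Input s m d → List Bool
  transcript (output _)    X = []
  transcript (speak i f k) X = f (X i) ∷ transcript (k (f (X i))) X

  speakers : BBProtocol s m d → Input s m d → List (Fin s)
  speakers (output _)    X = []
  speakers (speak i f k) X = i ∷ speakers (k (f (X i))) X

  cost≡length-transcript : ∀ P X → proj₂ (runBB P X) ≡ length (transcript P X)
  cost≡length-transcript (output _)    X = refl
  cost≡length-transcript (speak i f k) X = cong suc (cost≡length-transcript (k (f (X i))) X)

  length-speakers : ∀ P X → length (speakers P X) ≡ length (transcript P X)
  length-speakers (output _)    X = refl
  length-speakers (speak i f k) X = cong suc (length-speakers (k (f (X i))) X)

  rectangle : ∀ P {X Y Z} → transcript P X ≡ transcript P Y → (∀ j → Z j ≡ X j ⊎ Z j ≡ Y j) →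
              proj₁ (runBB P Z) ≡ proj₁ (runBB P X)
  rectangle (output _)    same choice = refl
  rectangle (speak i f k) {X} {Y} {Z} same choice =
    trans (cong (λ b → proj₁ (runBB (k b) Z)) same-bit) (rectangle (k (f (X i))) same-rest choice)
    where
      fXi≡fYi : f (X i) ≡ f (Y i)
      fXi≡fYi = List.∷-injectiveˡ same
      same-rest : transcript (k (f (X i))) X ≡ transcript (k (f (X i))) Y
      same-rest = trans (List.∷-injectiveʳ same) (cong (λ b → transcript (k b) Y) (sym fXi≡fYi))
      same-bit : f (Z i) ≡ f (X i)
      same-bit with choice i
      ... | inj₁ Zi≡Xi = cong f Zi≡Xi
      ... | inj₂ Zi≡Yi = trans (cong f Zi≡Yi) (sym fXi≡fYi)

  silent : ∀ P {X Z} → (∀ j → j ∈ speakers P X → Z j ≡ X j) → proj₁ (runBB P Z) ≡ proj₁ (runBB P X)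
  silent (output _)    agree = refl
  silent (speak i f k) {X} {Z} agree =
    trans (cong (λ b → proj₁ (runBB (k b) Z)) (cong f (agree i (here refl))))
          (silent (k (f (X i))) (λ j j∈ → agree j (there j∈)))

-- Lower bounds from a fooling set

∑-const : ∀ n c → ∑[ i < n ] c ≡ n * c
∑-const zero    c = refl
∑-const (suc n) c = cong (λ x → c + x) (∑-const n c)

∑-mono-≤ : ∀ {n} {f g : Fin n → ℕ} → (∀ i → f i ≤ g i) → ∑[ i < n ] f i ≤ ∑[ i < n ] g i
∑-mono-≤ {zero}  f≤g = z≤n
∑-mono-≤ {suc n} f≤g = ℕ.+-mono-≤ (f≤g zero) (∑-mono-≤ (f≤g ∘ suc))

maximum : ∀ {n} → 0 < n → (f : Fin n → ℕ) → ∃ λ V → ∀ W → f W ≤ f V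
maximum {suc zero}    _ f = zero , λ { zero → ℕ.≤-refl }
maximum {suc (suc n)} _ f with maximum (s≤s z≤n) (f ∘ suc)
... | V , max with ℕ.≤-total (f zero) (f (suc V))
...   | inj₁ f₀≤fV = suc V , λ { zero → f₀≤fV ; (suc W) → max W }
...   | inj₂ fV≤f₀ = zero  , λ { zero → ℕ.≤-refl ; (suc W) → ℕ.≤-trans (max W) fV≤f₀ }

∑≤max*n : ∀ {n} → 0 < n → (f : Fin n → ℕ) → ∃ λ V → ∑[ W < n ] f W ≤ f V * n
∑≤max*n {n} 0<n f with maximum 0<n f
... | V , max = V , ℕ.≤-trans (∑-mono-≤ max) (ℕ.≤-reflexive (trans (∑-const n (f V)) (ℕ.*-comm n (f V))))

cancel-half-error : ∀ a b g N → a * N ≤ b * N + a * g → 2 * g ≤ N → 0 < N → a ≤ 2 * b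
cancel-half-error a b g N aN≤bN+ag 2g≤N 0<N =
  ℕ.*-cancelʳ-≤ a (2 * b) N {{>-nonZero 0<N}} (ℕ.+-cancelˡ-≤ (a * N) _ _ (begin
    a * N + a * N            ≡⟨ solve 2 (λ a N → a :* N :+ a :* N := con 2 :* (a :* N)) refl a N ⟩
    2 * (a * N)              ≤⟨ ℕ.*-monoʳ-≤ 2 aN≤bN+ag ⟩
    2 * (b * N + a * g)      ≡⟨ solve 4 (λ a b g N → con 2 :* (b :* N :+ a :* g)
                                                  := a :* (con 2 :* g) :+ con 2 :* b :* N) refl a b g N ⟩
    a * (2 * g) + 2 * b * N  ≤⟨ ℕ.+-monoˡ-≤ (2 * b * N) (ℕ.*-monoʳ-≤ a 2g≤N) ⟩
    a * N + 2 * b * N        ∎))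
  where open ℕ.≤-Reasoning

complete⇒≤length : ∀ {n} (xs : List (Fin n)) → (∀ i → i ∈ xs) → n ≤ length xs
complete⇒≤length xs complete = Fin.injective⇒≤ λ {i} {j} eq →
  trans (lookup-index (complete i)) (trans (cong (lookup xs) eq) (sym (lookup-index (complete j))))

another : ∀ {s} → 2 ≤ s → (i : Fin s) → ∃ λ j → j ≢ i
another {suc zero}    (s≤s ()) zero
another {suc (suc s)} _ zero    = suc zero , λ ()
another {suc (suc s)} _ (suc i) = zero , λ ()

module LowerBounds {L m d N s : ℕ} (F : FoolingSet L m d N) (2≤s : 2 ≤ s) where
  open FoolingSet F

  uniform : Fin N → Input s (λ _ → m) d
  uniform V _ = system V

  mixed : Fin N → Fin s → Fin N → Input s (λ _ → m) d
  mixed V i W = updateAt (uniform V) i (const (system W))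

  mixed-≡ : ∀ V i W → mixed V i W i ≡ system W
  mixed-≡ V i W = Vector.updateAt-updates i (uniform V)

  mixed-≢ : ∀ V {i} W {j} → j ≢ i → mixed V i W j ≡ system V
  mixed-≢ V {i} W {j} j≢i = Vector.updateAt-minimal j i (uniform V) j≢i

  uniform-valid : ∀ V → ValidInput L (uniform V)
  uniform-valid V _ = bounded V

  mixed-valid : ∀ V i W → ValidInput L (mixed V i W)
  mixed-valid V i W j with j Fin.≟ i
  ... | yes refl = subst (λ S → ∀ r → BoundedRow L (S r)) (sym (mixed-≡ V j W)) (bounded W)
  ... | no  j≢i  = subst (λ S → ∀ r → BoundedRow L (S r)) (sym (mixed-≢ V W j≢i)) (bounded V)

  uniform-feasible : ∀ V → Feasible (uniform V)
  uniform-feasible V = proj₁ (solvable V) , λ _ → proj₂ (solvable V)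

  mixed-feasible⇒≡ : ∀ {V i W} → Feasible (mixed V i W) → V ≡ W
  mixed-feasible⇒≡ {V} {i} {W} (x , sat) = incompatible (solves (mixed-≢ V W j≢i)) (solves (mixed-≡ V i W))
    where
      j = proj₁ (another 2≤s i)
      j≢i = proj₂ (another 2≤s i)
      solves : ∀ {k U} → mixed V i W k ≡ system U → Solves (system U) x
      solves {k} eq = subst (λ S → Solves S x) eq (sat k)

  module _ (run : Input s (λ _ → m) d → Bool × ℕ) (correct : Decides L run) where

    accepts-uniform : ∀ V → proj₁ (run (uniform V)) ≡ true
    accepts-uniform V = proj₂ (correct (uniform V) (uniform-valid V)) (uniform-feasible V)

    accepts-mixed⇒≡ : ∀ {V i W} → proj₁ (run (mixed V i W)) ≡ true → V ≡ W
    accepts-mixed⇒≡ {V} {i} {W} = mixed-feasible⇒≡ ∘ proj₁ (correct (mixed V i W) (mixed-valid V i W))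

  module Coordinator (P : CoordProtocol s (λ _ → m) d) (correct : Decides L (runCoord P)) where
    open Run (strategy P)

    cost : Fin N → ℕ
    cost V = proj₂ (runCoord P (uniform V))

    history : Fin s → Fin N → ChannelHistory
    history i V = histories (uniform V) empty (tree P) i

    cost≡∑-history : ∀ V → cost V ≡ ∑[ i < s ] length (history i V)
    cost≡∑-history V = trans (sym (ℕ.+-identityʳ (cost V)))
      (trans (cong (λ n → cost V + n) (sym (sum-replicate-zero s))) (cost≡∑-length (uniform V) empty (tree P)))

    history-injective : ∀ i {V W} → history i V ≡ history i W → V ≡ W
    history-injective i {V} {W} same = accepts-mixed⇒≡ (runCoord P) correct
      (trans (rectangle {uniform V} {uniform W} {mixed V i W} (tree P) i same (mixed-≡ V i W) (λ j → mixed-≢ V W))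
             (accepts-uniform (runCoord P) correct V))

    ∑-history-lower-bound : ∀ t i → t * N ≤ 2 * ∑[ V < N ] length (history i V) + t * #shorter t
    ∑-history-lower-bound t i = subst (λ S → t * N ≤ S + t * #shorter t)
      (trans (sum-cong-≗ (length-encode ∘ history i)) (sym (*-distribˡ-sum 2 (λ V → length (history i V)))))
      (∑-length-lower-bound t (encode ∘ history i) (history-injective i ∘ encode-injective))

    ∑-cost-lower-bound : ∀ t → s * t * N ≤ 2 * ∑[ V < N ] cost V + s * t * #shorter t
    ∑-cost-lower-bound t = begin
      s * t * N                                   ≡⟨ trans (ℕ.*-assoc s t N) (sym (∑-const s (t * N))) ⟩
      ∑[ i < s ] (t * N)                          ≤⟨ ∑-mono-≤ (∑-history-lower-bound t) ⟩
      ∑[ i < s ] (2 * S i + t * g)                ≡⟨ ∑-distrib-+ (λ i → 2 * S i) (λ _ → t * g) ⟩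
      ∑[ i < s ] (2 * S i) + ∑[ i < s ] (t * g)
        ≡⟨ cong₂ _+_ (sym (*-distribˡ-sum 2 S)) (trans (∑-const s (t * g)) (sym (ℕ.*-assoc s t g))) ⟩
      2 * ∑[ i < s ] S i + s * t * g
        ≡⟨ cong (λ x → 2 * x + s * t * g) (∑-comm (λ i V → length (history i V))) ⟩
      2 * ∑[ V < N ] ∑[ i < s ] length (history i V) + s * t * g
        ≡⟨ cong (λ x → 2 * x + s * t * g) (sum-cong-≗ (sym ∘ cost≡∑-history)) ⟩
      2 * ∑[ V < N ] cost V + s * t * g           ∎
      where
        open ℕ.≤-Reasoning
        g = #shorter t
        S : Fin s → ℕ
        S i = ∑[ V < N ] length (history i V)

    bound : ∀ t → 0 < t → 2 * #shorter t ≤ N →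
            Σ ℕ λ c → CostAtLeast L (runCoord P) c × s * t ≤ 4 * c
    bound t 0<t 2g≤N = c , (uniform V* , uniform-valid V* , ℕ.≤-refl) , st≤4c
      where
        0<N : 0 < N
        0<N = ℕ.<-≤-trans (ℕ.*-monoʳ-< 2 (#shorter-pos t 0<t)) 2g≤N
        V* = proj₁ (∑≤max*n 0<N cost)
        c = cost V*
        ∑cost≤cN : 2 * ∑[ V < N ] cost V ≤ 2 * c * N
        ∑cost≤cN = ℕ.≤-trans (ℕ.*-monoʳ-≤ 2 (proj₂ (∑≤max*n 0<N cost)))
                             (ℕ.≤-reflexive (sym (ℕ.*-assoc 2 c N)))
        st≤4c : s * t ≤ 4 * c
        st≤4c = ℕ.≤-trans
          (cancel-half-error (s * t) (2 * c) (#shorter t) N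
            (ℕ.≤-trans (∑-cost-lower-bound t) (ℕ.+-monoˡ-≤ (s * t * #shorter t) ∑cost≤cN)) 2g≤N 0<N)
          (ℕ.≤-reflexive (sym (ℕ.*-assoc 2 2 c)))

  module Blackboard (P : BBProtocol s (λ _ → m) d) (correct : Decides L (runBB P)) where
    open BlackboardModel
    open DecMembership (Fin._≟_ {s}) using (_∈?_)

    cost : Fin N → ℕ
    cost V = proj₂ (runBB P (uniform V))

    transcript-injective : ∀ {V W} → transcript P (uniform V) ≡ transcript P (uniform W) → V ≡ W
    transcript-injective {V} {W} same =
      accepts-mixed⇒≡ (runBB P) correct (trans (rectangle P same choice) (accepts-uniform (runBB P) correct V))
      where
        i : Fin s
        i = Fin.fromℕ< (ℕ.<-≤-trans (s≤s z≤n) 2≤s)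
        choice : ∀ j → mixed V i W j ≡ uniform V j ⊎ mixed V i W j ≡ uniform W j
        choice j with j Fin.≟ i
        ... | yes refl = inj₂ (mixed-≡ V j W)
        ... | no  j≢i  = inj₁ (mixed-≢ V W j≢i)

    everyone-speaks : 2 ≤ N → ∀ V i → i ∈ speakers P (uniform V)
    everyone-speaks 2≤N V i with i ∈? speakers P (uniform V)
    ... | yes i∈ = i∈
    ... | no  i∉ = contradiction (sym (accepts-mixed⇒≡ (runBB P) correct
                      (trans (silent P agree) (accepts-uniform (runBB P) correct V)))) W≢V
      where
        W = proj₁ (another 2≤N V)
        W≢V = proj₂ (another 2≤N V)
        agree : ∀ j → j ∈ speakers P (uniform V) → mixed V i W j ≡ uniform V j
        agree j j∈ = mixed-≢ V W λ { refl → i∉ j∈ }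

    s≤cost : 2 ≤ N → ∀ V → s ≤ cost V
    s≤cost 2≤N V = ℕ.≤-trans (complete⇒≤length (speakers P (uniform V)) (everyone-speaks 2≤N V))
      (ℕ.≤-reflexive (trans (length-speakers P (uniform V)) (sym (cost≡length-transcript P (uniform V)))))

    ∑-cost-lower-bound : ∀ t → t * N ≤ ∑[ V < N ] cost V + t * #shorter t
    ∑-cost-lower-bound t =
      subst (λ S → t * N ≤ S + t * #shorter t)
            (sum-cong-≗ (λ V → sym (cost≡length-transcript P (uniform V))))
        (∑-length-lower-bound t (λ V → transcript P (uniform V)) transcript-injective)

    bound : ∀ t → 0 < t → 2 * #shorter t ≤ N →
            Σ ℕ λ c → CostAtLeast L (runBB P) c × s ≤ c × t ≤ 2 * c
    bound t 0<t 2g≤N = c , (uniform V* , uniform-valid V* , ℕ.≤-refl) , s≤cost 2≤N V* , t≤2c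
      where
        2≤N : 2 ≤ N
        2≤N = ℕ.≤-trans (ℕ.*-monoʳ-≤ 2 (#shorter-pos t 0<t)) 2g≤N
        0<N : 0 < N
        0<N = ℕ.<-≤-trans (s≤s z≤n) 2≤N
        V* = proj₁ (∑≤max*n 0<N cost)
        c = cost V*
        t≤2c : t ≤ 2 * c
        t≤2c = cancel-half-error t c (#shorter t) N
          (ℕ.≤-trans (∑-cost-lower-bound t) (ℕ.+-monoˡ-≤ (t * #shorter t) (proj₂ (∑≤max*n 0<N cost))))
          2g≤N 0<N

⌈n/2⌉-pos : ∀ {n} → 0 < n → 0 < ⌈ n /2⌉
⌈n/2⌉-pos {suc n} _ = s≤s z≤n

n≤2⌈n/2⌉ : ∀ n → n ≤ 2 * ⌈ n /2⌉
n≤2⌈n/2⌉ n = begin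
  n                  ≡⟨ ℕ.⌊n/2⌋+⌈n/2⌉≡n n ⟨
  ⌊ n /2⌋ + ⌈ n /2⌉  ≤⟨ ℕ.+-monoˡ-≤ ⌈ n /2⌉ (ℕ.⌊n/2⌋≤⌈n/2⌉ n) ⟩
  ⌈ n /2⌉ + ⌈ n /2⌉  ≡⟨ cong (λ x → ⌈ n /2⌉ + x) (ℕ.+-identityʳ ⌈ n /2⌉) ⟨
  2 * ⌈ n /2⌉        ∎
  where open ℕ.≤-Reasoning

2*#shorter⌈n/2⌉≤2^n : ∀ n → 0 < n → 2 * #shorter ⌈ n /2⌉ ≤ 2 ^ n
2*#shorter⌈n/2⌉≤2^n (suc zero)          _ = ℕ.≤-refl
2*#shorter⌈n/2⌉≤2^n (suc (suc zero))    _ = s≤s (s≤s z≤n)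
2*#shorter⌈n/2⌉≤2^n (suc (suc (suc n))) _ = begin
  2 * suc (2 * g)                ≡⟨ ℕ.*-suc 2 (2 * g) ⟩
  2 + 2 * (2 * g)                ≤⟨ ℕ.+-mono-≤ (ℕ.*-monoʳ-≤ 2 (ℕ.m^n>0 2 (suc n)))
                                                (ℕ.*-monoʳ-≤ 2 (2*#shorter⌈n/2⌉≤2^n (suc n) (s≤s z≤n))) ⟩
  2 * 2 ^ suc n + 2 * 2 ^ suc n  ≡⟨ solve 1 (λ x → con 2 :* x :+ con 2 :* x := con 2 :* (con 2 :* x))
                                           refl (2 ^ suc n) ⟩
  2 ^ suc (suc (suc n))          ∎
  where
    open ℕ.≤-Reasoning
    g = #shorter ⌈ suc n /2⌉

d²≤4[1+⌊d/2⌋]⌈d/2⌉ : ∀ d → d * d ≤ 4 * (suc ⌊ d /2⌋ * ⌈ d /2⌉)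
d²≤4[1+⌊d/2⌋]⌈d/2⌉ d = begin
  d * d                      ≡⟨ cong (λ e → e * e) (ℕ.⌊n/2⌋+⌈n/2⌉≡n d) ⟨
  (k + r) * (k + r)          ≤⟨ ℕ.*-mono-≤ (ℕ.+-mono-≤ (ℕ.n≤1+n k) r≤1+k)
                                           (ℕ.+-monoˡ-≤ r (ℕ.⌊n/2⌋≤⌈n/2⌉ d)) ⟩
  (suc k + suc k) * (r + r)  ≡⟨ solve 2 (λ k r → (con 1 :+ k :+ (con 1 :+ k)) :* (r :+ r)
                                              := con 4 :* ((con 1 :+ k) :* r)) refl k r ⟩
  4 * (suc k * r)            ∎
  where
    open ℕ.≤-Reasoning
    k = ⌊ d /2⌋
    r = ⌈ d /2⌉
    r≤1+k : r ≤ suc k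
    r≤1+k = ℕ.⌊n/2⌋-mono (ℕ.n≤1+n (suc d))

d²L≤8⌈n/2⌉ : ∀ d L → d * d * L ≤ 8 * ⌈ L * (suc ⌊ d /2⌋ * ⌈ d /2⌉) /2⌉
d²L≤8⌈n/2⌉ d L = begin
  d * d * L          ≤⟨ ℕ.*-monoˡ-≤ L (d²≤4[1+⌊d/2⌋]⌈d/2⌉ d) ⟩
  4 * q * L          ≡⟨ solve 2 (λ q L → con 4 :* q :* L := con 4 :* (L :* q)) refl q L ⟩
  4 * n              ≤⟨ ℕ.*-monoʳ-≤ 4 (n≤2⌈n/2⌉ n) ⟩
  4 * (2 * ⌈ n /2⌉)  ≡⟨ ℕ.*-assoc 4 2 ⌈ n /2⌉ ⟨
  8 * ⌈ n /2⌉        ∎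
  where
    open ℕ.≤-Reasoning
    q = suc ⌊ d /2⌋ * ⌈ d /2⌉
    n = L * q

s*d²*L≤32*c : ∀ s d L c → s * ⌈ L * (suc ⌊ d /2⌋ * ⌈ d /2⌉) /2⌉ ≤ 4 * c →
              s * (d * d) * L ≤ 32 * c
s*d²*L≤32*c s d L c st≤4c = begin
  s * (d * d) * L  ≡⟨ ℕ.*-assoc s (d * d) L ⟩
  s * (d * d * L)  ≤⟨ ℕ.*-monoʳ-≤ s (d²L≤8⌈n/2⌉ d L) ⟩
  s * (8 * t)      ≡⟨ solve 2 (λ s t → s :* (con 8 :* t) := con 8 :* (s :* t)) refl s t ⟩
  8 * (s * t)      ≤⟨ ℕ.*-monoʳ-≤ 8 st≤4c ⟩
  8 * (4 * c)      ≡⟨ ℕ.*-assoc 8 4 c ⟨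
  32 * c           ∎
  where
    open ℕ.≤-Reasoning
    t = ⌈ L * (suc ⌊ d /2⌋ * ⌈ d /2⌉) /2⌉

s+d²*L≤32*c : ∀ s d L c → s ≤ c → ⌈ L * (suc ⌊ d /2⌋ * ⌈ d /2⌉) /2⌉ ≤ 2 * c →
              s + d * d * L ≤ 32 * c
s+d²*L≤32*c s d L c s≤c t≤2c = begin
  s + d * d * L
    ≤⟨ ℕ.+-mono-≤ s≤c (ℕ.≤-trans (d²L≤8⌈n/2⌉ d L) (ℕ.*-monoʳ-≤ 8 t≤2c)) ⟩
  c + 8 * (2 * c)
    ≤⟨ ℕ.m≤m+n (c + 8 * (2 * c)) (15 * c) ⟩
  c + 8 * (2 * c) + 15 * c
    ≡⟨ solve 1 (λ c → c :+ con 8 :* (con 2 :* c) :+ con 15 :* c := con 32 :* c) refl c ⟩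
  32 * c ∎
  where open ℕ.≤-Reasoning

theorem3p7 : Σ ℕ λ K → (0 < K) ×
    ((s d L : ℕ) → 2 ≤ s → 1 ≤ d → 1 ≤ L →
    Σ (Fin s → ℕ) λ m →
    ((P : CoordProtocol s m d) → Decides L (runCoord P) →
    Σ ℕ λ c → CostAtLeast L (runCoord P) c × (s * (d * d) * L ≤ K * c))
    ×
    ((P : BBProtocol s m d) → Decides L (runBB P) →
    Σ ℕ λ c → CostAtLeast L (runBB P) c × (s + d * d * L ≤ K * c)))
theorem3p7 .proj₁ = 32
theorem3p7 .proj₂ .proj₁ = s≤s z≤n
theorem3p7 .proj₂ .proj₂ s d L 2≤s 1≤d 1≤L = (λ _ → d) , coordinator , blackboard
  where
    n = L * (suc ⌊ d /2⌋ * ⌈ d /2⌉)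
    0<n : 0 < n
    0<n = ℕ.*-mono-≤ 1≤L (ℕ.*-mono-≤ {1} {suc ⌊ d /2⌋} (s≤s z≤n) (⌈n/2⌉-pos 1≤d))
    open LowerBounds (gadget d L) 2≤s

    coordinator : (P : CoordProtocol s (λ _ → d) d) → Decides L (runCoord P) →
                  Σ ℕ λ c → CostAtLeast L (runCoord P) c × (s * (d * d) * L ≤ 32 * c)
    coordinator P correct = map₂ (λ {c} → map₂ (s*d²*L≤32*c s d L c))
      (Coordinator.bound P correct ⌈ n /2⌉ (⌈n/2⌉-pos 0<n) (2*#shorter⌈n/2⌉≤2^n n 0<n))

    blackboard : (P : BBProtocol s (λ _ → d) d) → Decides L (runBB P) →
                 Σ ℕ λ c → CostAtLeast L (runBB P) c × (s + d * d * L ≤ 32 * c)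
    blackboard P correct = map₂ (λ {c} → map₂ (uncurry (s+d²*L≤32*c s d L c)))
      (Blackboard.bound P correct ⌈ n /2⌉ (⌈n/2⌉-pos 0<n) (2*#shorter⌈n/2⌉≤2^n n 0<n))
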